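{- For all positive integers $p,q$, $$A_{p,q}(t)=A_{p,q-1}(t)+A_{p-1,q}(t)+(p+q-1)\,t\,A_{p-1,q-1}(t),$$ with initial conditions $A_{p,0}(t)=A_{0,q}(t)=1$ for all $p,q\ge0$.
   Context: A signed $(p,q)$-involution ($p,q\ge0$, $n=p+q$) is an involution $\pi$ of $\{1,\dots,n\}$ together with a sign $+$ or $-$ on each fixed point such that (number of $+$) $-$ (number of $-$) $=p-q$. $\gamma_{k,p,q}$ is the number of signed $(p,q)$-involutions with exactly $k$ 2-cycles, and $A_{p,q}(t)=\sum_{k=0}^{q}\gamma_{k,p,q}t^k$. -}

module Defs where

open import Data.Nat using (ℕ; zero; suc; _+_; _*_; _∸_; _≤ᵇ_; _≡ᵇ_; _<ᵇ_)
open import Data.Bool using (Bool; true; false; _∧_; _∨_; not; if_then_else_)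
open import Data.Fin using (Fin; toℕ) renaming (_≟_ to _≟ᶠ_)
open import Data.List using (List; []; _∷_; map; concatMap; length; filterᵇ; allFin; cartesianProduct)
open import Data.Vec using (Vec; []; _∷_; lookup)
open import Data.Product using (_×_; _,_)
open import Relation.Nullary.Decidable using (⌊_⌋)
open import Relation.Binary.PropositionalEquality using (_≡_)

allVecs : {A : Set} → List A → (m : ℕ) → List (Vec A m)
allVecs xs zero    = [] ∷ []
allVecs xs (suc m) = concatMap (λ x → map (x ∷_) (allVecs xs m)) xs

allᵇ : {A : Set} → (A → Bool) → List A → Bool
allᵇ P []       = true
allᵇ P (x ∷ xs) = P x ∧ allᵇ P xs

countFin : (n : ℕ) → (Fin n → Bool) → ℕ
countFin n P = length (filterᵇ P (allFin n))

-- Signed involutions on {1,…,n}, encoded as pairs (π , s):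
--   π : Vec (Fin n) n   the map i ↦ π(i)
--   s : Vec Bool n      s i = true means sign + , false means sign −
-- Signs are only meaningful on fixed points; to make the encoding
-- bijective we require s i = true (a dummy value) whenever π i ≠ i.

isInvolution : {n : ℕ} → Vec (Fin n) n → Bool
isInvolution {n} π = allᵇ (λ i → ⌊ lookup π (lookup π i) ≟ᶠ i ⌋) (allFin n)

isFixed : {n : ℕ} → Vec (Fin n) n → Fin n → Bool
isFixed π i = ⌊ lookup π i ≟ᶠ i ⌋

signsNormalised : {n : ℕ} → Vec (Fin n) n → Vec Bool n → Bool
signsNormalised {n} π s = allᵇ (λ i → isFixed π i ∨ lookup s i) (allFin n)

-- number of 2-cycles: each 2-cycle {i, π i} counted once via i < π i
twoCycles : {n : ℕ} → Vec (Fin n) n → ℕ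
twoCycles {n} π = countFin n (λ i → toℕ i <ᵇ toℕ (lookup π i))

plusFixed : {n : ℕ} → Vec (Fin n) n → Vec Bool n → ℕ
plusFixed {n} π s = countFin n (λ i → isFixed π i ∧ lookup s i)

minusFixed : {n : ℕ} → Vec (Fin n) n → Vec Bool n → ℕ
minusFixed {n} π s = countFin n (λ i → isFixed π i ∧ not (lookup s i))

-- (π , s) is a signed (p,q)-involution (n = p + q) with exactly k 2-cycles.
-- The balance condition (#+) − (#−) = p − q is written as (#+) + q = (#−) + p.
isSignedInvWithK : (k p q : ℕ) → Vec (Fin (p + q)) (p + q) × Vec Bool (p + q) → Bool
isSignedInvWithK k p q (π , s) =
  isInvolution π ∧ signsNormalised π s ∧ (twoCycles π ≡ᵇ k)
  ∧ ((plusFixed π s + q) ≡ᵇ (minusFixed π s + p))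

γ : (k p q : ℕ) → ℕ
γ k p q = length (filterᵇ (isSignedInvWithK k p q)
            (cartesianProduct (allVecs (allFin (p + q)) (p + q))
                              (allVecs (true ∷ false ∷ []) (p + q))))

-- Polynomials in t with ℕ coefficients, as coefficient functions
-- (coefficient of t^k), compared coefficientwise.

Poly : Set
Poly = ℕ → ℕ

_≈ₚ_ : Poly → Poly → Set
f ≈ₚ g = ∀ k → f k ≡ g k

_⊕_ : Poly → Poly → Poly
(f ⊕ g) k = f k + g k
infixl 6 _⊕_

_·_ : ℕ → Poly → Poly
(c · f) k = c * f k
infixl 7 _·_

t× : Poly → Poly
t× f zero    = 0
t× f (suc k) = f k

onePoly : Poly
onePoly zero    = 1
onePoly (suc k) = 0

A : ℕ → ℕ → Poly
A p q k = if k ≤ᵇ q then γ k p q else 0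

-- Classify a signed involution on n + 1 points by its first point:
-- fixed with sign −, fixed with sign +, or in a 2-cycle with one of the other
-- n points.  Deleting that point (resp. that 2-cycle) is a bijection onto the
-- signed involutions on n (resp. n − 1) points, and it lowers the statistics
-- (#2-cycles c, #(+)-fixed a, #(−)-fixed m) in the m-, a- resp. c-slot by one.
-- So that the recursion can run, we count the candidates accepted by an
-- arbitrary weight W on (c, a, m): γ_{k,p,q} is the count for the "balanced"
-- weight on p + q points, and the recurrence for counts specialises to the
-- recurrence for γ.  The truncation k ≤ q in A and the initial values follow
-- because only statistics with a + m + 2c = n occur (proved by the same
-- induction).

module Submission where

open import Data.Bool using (Bool; true; false; _∧_; _∨_; not; T)
open import Data.Bool.Properties using (T-∧; T-∨; T-≡; ∧-zeroʳ; ∧-identityʳ; ∨-zeroʳ) renaming (_≟_ to _≟ᵇ_)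
open import Data.Empty using (⊥; ⊥-elim)
open import Data.Fin using (Fin; zero; suc; toℕ; punchIn; punchOut) renaming (_≟_ to _≟ᶠ_)
open import Data.Fin.Properties using (0≢1+n; suc-injective; punchIn-injective; punchInᵢ≢i; punchOut-cong; punchOut-punchIn; punchIn-punchOut)
open import Data.List using (List; []; _∷_; map; concatMap; concat; length; filterᵇ; allFin; cartesianProduct; tabulate; _++_)
open import Data.Nat using (ℕ; zero; suc; _+_; _*_; _∸_; _≤_; _<_; _≡ᵇ_; _<ᵇ_; _≤ᵇ_)
open import Data.Nat.Properties using (_≟_; +-assoc; +-comm; +-identityʳ; +-suc; *-zeroʳ; *-identityʳ; *-distribˡ-+; *-cancelˡ-≡; +-cancelˡ-≡; ≡ᵇ⇒≡; ≤⇒≤ᵇ; <⇒≱; ≰⇒>; m≤n+m; m+n≡0⇒n≡0) renaming (0≢1+n to ℕ-0≢1+n)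
open import Data.Product using (_×_; _,_; proj₁; proj₂; uncurry)
open import Data.Product.Properties using (,-injective)
open import Data.Unit using (tt)
open import Data.Vec using (Vec; []; _∷_; lookup) renaming (map to mapᵛ; tabulate to tabulateᵛ)
open import Data.Vec.Properties using (lookup-map; tabulate-∘; lookup∘tabulate; tabulate∘lookup; tabulate-cong) renaming (≡-dec to ≡-decᵛ)
open import Data.Vec.Functional using (insertAt)
open import Data.Vec.Functional.Properties using (insertAt-lookup; insertAt-punchIn)
open import Data.Sum using (inj₁; inj₂)
open import Data.Nat.Tactic.RingSolver using (solve-∀)
open import Function using (_∘_; id; _⇔_; mk⇔; Equivalence)
open import Relation.Binary.Definitions using (DecidableEquality)
open import Relation.Binary.PropositionalEquality using (_≡_; refl; sym; trans; cong; cong₂; subst; _≢_; module ≡-Reasoning)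
open import Relation.Nullary using (yes; no)
open import Relation.Nullary.Decidable using (does; ⌊_⌋; toWitness; map′; _×-dec_; T?; does-⇔)

open import Defs

variable
  X Y : Set

𝟙 : Bool → ℕ
𝟙 true  = 1
𝟙 false = 0

𝟙-∧ : ∀ a b → 𝟙 (a ∧ b) ≡ 𝟙 a * 𝟙 b
𝟙-∧ true  b = sym (+-identityʳ (𝟙 b))
𝟙-∧ false b = refl

-- Truth of a conjunction, with the first conjunct given explicitly for inference.
∧-elim : ∀ a {b} → T (a ∧ b) → T a × T b
∧-elim true t = tt , t

false-unless : ∀ {b} → (T b → ⊥) → b ≡ false
false-unless {false} _   = refl
false-unless {true}  ¬tt = ⊥-elim (¬tt tt)

≡ᵇ-⇔ : ∀ {x y u v} → (x ≡ y ⇔ u ≡ v) → (x ≡ᵇ y) ≡ (u ≡ᵇ v)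
≡ᵇ-⇔ {x} {y} {u} {v} iff = does-⇔ iff (x ≟ y) (u ≟ v)

⌊≟⌋-refl : ∀ {n} (i : Fin n) → ⌊ i ≟ᶠ i ⌋ ≡ true
⌊≟⌋-refl i with i ≟ᶠ i
... | yes _ = refl
... | no ne = ⊥-elim (ne refl)

≟ᵇ-refl : ∀ b → ⌊ b ≟ᵇ b ⌋ ≡ true
≟ᵇ-refl true  = refl
≟ᵇ-refl false = refl

⌊≟⌋-injective : ∀ {m n} (e : Fin m → Fin n) → (∀ {a b} → e a ≡ e b → a ≡ b) →
                ∀ a b → ⌊ e a ≟ᶠ e b ⌋ ≡ ⌊ a ≟ᶠ b ⌋
⌊≟⌋-injective e e-injective a b with a ≟ᶠ b | e a ≟ᶠ e b
... | yes refl | yes _  = refl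
... | yes refl | no ne  = ⊥-elim (ne refl)
... | no ne    | yes eq = ⊥-elim (ne (e-injective eq))
... | no _     | no _   = refl

sumL : List X → (X → ℕ) → ℕ
sumL []       h = 0
sumL (x ∷ xs) h = h x + sumL xs h

length-filter : (P : X → Bool) (xs : List X) → length (filterᵇ P xs) ≡ sumL xs (𝟙 ∘ P)
length-filter P []       = refl
length-filter P (x ∷ xs) with P x
... | true  = cong suc (length-filter P xs)
... | false = length-filter P xs

sumL-cong : (xs : List X) {h h′ : X → ℕ} → (∀ x → h x ≡ h′ x) → sumL xs h ≡ sumL xs h′
sumL-cong []       e = refl
sumL-cong (x ∷ xs) e = cong₂ _+_ (e x) (sumL-cong xs e)

sumL-+ : (xs : List X) (h h′ : X → ℕ) → sumL xs (λ x → h x + h′ x) ≡ sumL xs h + sumL xs h′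
sumL-+ []       h h′ = refl
sumL-+ (x ∷ xs) h h′ = begin
  h x + h′ x + sumL xs (λ x → h x + h′ x)  ≡⟨ cong (h x + h′ x +_) (sumL-+ xs h h′) ⟩
  h x + h′ x + (sumL xs h + sumL xs h′)    ≡⟨ +-interchange (h x) (h′ x) (sumL xs h) (sumL xs h′) ⟩
  h x + sumL xs h + (h′ x + sumL xs h′)    ∎
  where
  open ≡-Reasoning
  +-interchange : ∀ a b c d → a + b + (c + d) ≡ a + c + (b + d)
  +-interchange = solve-∀

sumL-*ˡ : (xs : List X) (c : ℕ) (h : X → ℕ) → sumL xs (λ x → c * h x) ≡ c * sumL xs h
sumL-*ˡ []       c h = sym (*-zeroʳ c)
sumL-*ˡ (x ∷ xs) c h = trans (cong (c * h x +_) (sumL-*ˡ xs c h)) (sym (*-distribˡ-+ c (h x) (sumL xs h)))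

sumL-zero : (xs : List X) → sumL xs (λ _ → 0) ≡ 0
sumL-zero []       = refl
sumL-zero (x ∷ xs) = sumL-zero xs

sumL-++ : (xs ys : List X) (h : X → ℕ) → sumL (xs ++ ys) h ≡ sumL xs h + sumL ys h
sumL-++ []       ys h = refl
sumL-++ (x ∷ xs) ys h = trans (cong (h x +_) (sumL-++ xs ys h)) (sym (+-assoc (h x) (sumL xs h) (sumL ys h)))

sumL-map : (f : X → Y) (xs : List X) (h : Y → ℕ) → sumL (map f xs) h ≡ sumL xs (h ∘ f)
sumL-map f []       h = refl
sumL-map f (x ∷ xs) h = cong (h (f x) +_) (sumL-map f xs h)

sumL-concatMap : (f : X → List Y) (xs : List X) (h : Y → ℕ) →
                 sumL (concatMap f xs) h ≡ sumL xs (λ x → sumL (f x) h)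
sumL-concatMap f []       h = refl
sumL-concatMap f (x ∷ xs) h =
  trans (sumL-++ (f x) (concat (map f xs)) h) (cong (sumL (f x) h +_) (sumL-concatMap f xs h))

sumL-swap : (xs : List X) (ys : List Y) (h : X → Y → ℕ) →
            sumL xs (λ x → sumL ys (h x)) ≡ sumL ys (λ y → sumL xs (λ x → h x y))
sumL-swap []       ys h = sym (sumL-zero ys)
sumL-swap (x ∷ xs) ys h =
  trans (cong (sumL ys (h x) +_) (sumL-swap xs ys h)) (sym (sumL-+ ys (h x) (λ y → sumL xs (λ x → h x y))))

sumL-cartesian : (xs : List X) (ys : List Y) (h : X × Y → ℕ) →
                 sumL (cartesianProduct xs ys) h ≡ sumL xs (λ x → sumL ys (λ y → h (x , y)))
sumL-cartesian []       ys h = refl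
sumL-cartesian (x ∷ xs) ys h =
  trans (sumL-++ (map (x ,_) ys) (cartesianProduct xs ys) h)
        (cong₂ _+_ (sumL-map (x ,_) ys h) (sumL-cartesian xs ys h))

sumL-allVecs : (xs : List X) (m : ℕ) (h : Vec X (suc m) → ℕ) →
               sumL (allVecs xs (suc m)) h ≡ sumL xs (λ x → sumL (allVecs xs m) (λ v → h (x ∷ v)))
sumL-allVecs xs m h =
  trans (sumL-concatMap (λ x → map (x ∷_) (allVecs xs m)) xs h)
        (sumL-cong xs (λ x → sumL-map (x ∷_) (allVecs xs m) h))

ΣF : (n : ℕ) → (Fin n → ℕ) → ℕ
ΣF zero    h = 0
ΣF (suc n) h = h zero + ΣF n (h ∘ suc)

AllF : (n : ℕ) → (Fin n → Bool) → Bool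
AllF zero    h = true
AllF (suc n) h = h zero ∧ AllF n (h ∘ suc)

ΣF-cong : ∀ n {h h′ : Fin n → ℕ} → (∀ i → h i ≡ h′ i) → ΣF n h ≡ ΣF n h′
ΣF-cong zero    e = refl
ΣF-cong (suc n) e = cong₂ _+_ (e zero) (ΣF-cong n (e ∘ suc))

AllF-cong : ∀ n {h h′ : Fin n → Bool} → (∀ i → h i ≡ h′ i) → AllF n h ≡ AllF n h′
AllF-cong zero    e = refl
AllF-cong (suc n) e = cong₂ _∧_ (e zero) (AllF-cong n (e ∘ suc))

ΣF-const : ∀ n c → ΣF n (λ _ → c) ≡ n * c
ΣF-const zero    c = refl
ΣF-const (suc n) c = cong (c +_) (ΣF-const n c)

ΣF-punchIn : ∀ n (j : Fin (suc n)) (h : Fin (suc n) → ℕ) → ΣF (suc n) h ≡ h j + ΣF n (h ∘ punchIn j)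
ΣF-punchIn n       zero    h = refl
ΣF-punchIn (suc n) (suc j) h = begin
  h zero + ΣF (suc n) (h ∘ suc)                      ≡⟨ cong (h zero +_) (ΣF-punchIn n j (h ∘ suc)) ⟩
  h zero + (h (suc j) + ΣF n (h ∘ suc ∘ punchIn j))  ≡⟨ +-left-swap (h zero) (h (suc j)) _ ⟩
  h (suc j) + (h zero + ΣF n (h ∘ suc ∘ punchIn j))  ∎
  where
  open ≡-Reasoning
  +-left-swap : ∀ a b c → a + (b + c) ≡ b + (a + c)
  +-left-swap = solve-∀

AllF-punchIn : ∀ n (j : Fin (suc n)) (h : Fin (suc n) → Bool) → AllF (suc n) h ≡ h j ∧ AllF n (h ∘ punchIn j)
AllF-punchIn n       zero    h = refl
AllF-punchIn (suc n) (suc j) h = trans (cong (h zero ∧_) (AllF-punchIn n j (h ∘ suc))) (∧-left-swap (h zero) (h (suc j)) _)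
  where
  ∧-left-swap : ∀ a b c → a ∧ (b ∧ c) ≡ b ∧ (a ∧ c)
  ∧-left-swap false false c = refl
  ∧-left-swap false true  c = refl
  ∧-left-swap true  b     c = refl

AllF-elim : ∀ n {h : Fin n → Bool} → T (AllF n h) → ∀ i → T (h i)
AllF-elim (suc n) {h} all zero    = proj₁ (Equivalence.to T-∧ all)
AllF-elim (suc n) {h} all (suc i) = AllF-elim n (proj₂ (Equivalence.to (T-∧ {h zero}) all)) i

sumL-tabulate : ∀ n (f : Fin n → X) (h : X → ℕ) → sumL (tabulate f) h ≡ ΣF n (h ∘ f)
sumL-tabulate zero    f h = refl
sumL-tabulate (suc n) f h = cong (h (f zero) +_) (sumL-tabulate n (f ∘ suc) h)

allᵇ-tabulate : ∀ n (f : Fin n → X) (P : X → Bool) → allᵇ P (tabulate f) ≡ AllF n (P ∘ f)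
allᵇ-tabulate zero    f P = refl
allᵇ-tabulate (suc n) f P = cong (P (f zero) ∧_) (allᵇ-tabulate n (f ∘ suc) P)

countFin-ΣF : ∀ n (P : Fin n → Bool) → countFin n P ≡ ΣF n (𝟙 ∘ P)
countFin-ΣF n P = trans (length-filter P (allFin n)) (sumL-tabulate n id (𝟙 ∘ P))

-- An exact enumeration of X (relative to a decidable equality) is a list
-- containing every element exactly once, i.e. Σₓ δ(x, y) = 1 for all y.

δ : DecidableEquality X → X → X → ℕ
δ _≟_ a b = 𝟙 (does (a ≟ b))

record Enumeration (_≟_ : DecidableEquality X) (xs : List X) : Set where
  constructor enumerates
  field
    counts-once : ∀ y → sumL xs (λ x → δ _≟_ x y) ≡ 1
open Enumeration

enumeration-select : {_≟_ : DecidableEquality X} {xs : List X} → Enumeration _≟_ xs →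
                     ∀ y c → sumL xs (λ x → c * δ _≟_ x y) ≡ c
enumeration-select {xs = xs} enum y c =
  trans (sumL-*ˡ xs c _) (trans (cong (c *_) (counts-once enum y)) (*-identityʳ c))

_≟×_ : DecidableEquality X → DecidableEquality Y → DecidableEquality (X × Y)
(_≟ˣ_ ≟× _≟ʸ_) (a , x) (b , y) = map′ (uncurry (cong₂ _,_)) ,-injective ((a ≟ˣ b) ×-dec (x ≟ʸ y))

enumeration-cartesian : {_≟ˣ_ : DecidableEquality X} {_≟ʸ_ : DecidableEquality Y} {xs : List X} {ys : List Y} →
                        Enumeration _≟ˣ_ xs → Enumeration _≟ʸ_ ys →
                        Enumeration (_≟ˣ_ ≟× _≟ʸ_) (cartesianProduct xs ys)
enumeration-cartesian {_≟ˣ_ = _≟ˣ_} {_≟ʸ_} {xs} {ys} enumˣ enumʸ = enumerates counts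
  where
  counts : ∀ z → sumL (cartesianProduct xs ys) (λ w → δ (_≟ˣ_ ≟× _≟ʸ_) w z) ≡ 1
  counts (b , y) =
    trans (sumL-cartesian xs ys _)
          (trans (sumL-cong xs (λ a → trans (sumL-cong ys (λ x → 𝟙-∧ (does (a ≟ˣ b)) _))
                                            (enumeration-select enumʸ y (δ _≟ˣ_ a b))))
                 (counts-once enumˣ b))

enumeration-allVecs : {_≟_ : DecidableEquality X} {xs : List X} → Enumeration _≟_ xs →
                      ∀ m → Enumeration (≡-decᵛ _≟_) (allVecs xs m)
enumeration-allVecs {_≟_ = _≟_} {xs} enum m = enumerates (counts m)
  where
  counts : ∀ m (w : Vec _ m) → sumL (allVecs xs m) (λ u → δ (≡-decᵛ _≟_) u w) ≡ 1
  counts zero    []      = refl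
  counts (suc m) (b ∷ v) =
    trans (sumL-allVecs xs m _)
          (trans (sumL-cong xs (λ a → trans (sumL-cong (allVecs xs m) (λ u → 𝟙-∧ (does (a ≟ b)) _))
                                            (enumeration-select (enumerates {_≟_ = ≡-decᵛ _≟_} {allVecs xs m} (counts m)) v (δ _≟_ a b))))
                 (counts-once enum b))

enumeration-Bool : Enumeration _≟ᵇ_ (true ∷ false ∷ [])
enumeration-Bool = enumerates λ { true → refl ; false → refl }

enumeration-allFin : ∀ n → Enumeration _≟ᶠ_ (allFin n)
enumeration-allFin n = enumerates λ y → trans (sumL-tabulate n id _) (ΣF-δ n y)
  where
  ΣF-δ : ∀ n (y : Fin n) → ΣF n (λ x → δ _≟ᶠ_ x y) ≡ 1
  ΣF-δ (suc n) zero    = cong suc (trans (ΣF-const n 0) (*-zeroʳ n))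
  ΣF-δ (suc n) (suc y) = ΣF-δ n y

-- Both counts equal the number of pairs (x, y) with P x and y = f x.
bijection-count : {_≟ˣ_ : DecidableEquality X} {_≟ʸ_ : DecidableEquality Y} {xs : List X} {ys : List Y} →
                  Enumeration _≟ˣ_ xs → Enumeration _≟ʸ_ ys →
                  (P : X → Bool) (Q : Y → Bool) (f : X → Y) (g : Y → X) →
                  (∀ y → P (g y) ≡ Q y) → (∀ x → T (P x) → g (f x) ≡ x) → (∀ y → f (g y) ≡ y) →
                  sumL xs (𝟙 ∘ P) ≡ sumL ys (𝟙 ∘ Q)
bijection-count {X} {Y} {_≟ˣ_} {_≟ʸ_} {xs} {ys} enumˣ enumʸ P Q f g P∘g g∘f f∘g = begin
  sumL xs (𝟙 ∘ P)                                           ≡⟨ sumL-cong xs (λ x → sym (enumeration-select enumʸ (f x) (𝟙 (P x)))) ⟩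
  sumL xs (λ x → sumL ys (λ y → 𝟙 (P x) * δ _≟ʸ_ y (f x)))  ≡⟨ sumL-swap xs ys _ ⟩
  sumL ys (λ y → sumL xs (λ x → 𝟙 (P x) * δ _≟ʸ_ y (f x)))  ≡⟨ sumL-cong ys (λ y → sumL-cong xs (λ x → graph-transpose x y)) ⟩
  sumL ys (λ y → sumL xs (λ x → 𝟙 (Q y) * δ _≟ˣ_ x (g y)))  ≡⟨ sumL-cong ys (λ y → enumeration-select enumˣ (g y) (𝟙 (Q y))) ⟩
  sumL ys (𝟙 ∘ Q)                                           ∎
  where
  open ≡-Reasoning
  graph : ∀ x y → (T (P x) × y ≡ f x) ⇔ (T (Q y) × x ≡ g y)
  graph x y = mk⇔ (λ { (px , refl) → subst T (trans (cong P (sym (g∘f x px))) (P∘g (f x))) px , sym (g∘f x px) })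
                  (λ { (qy , refl) → subst T (sym (P∘g y)) qy , sym (f∘g y) })
  graph-transpose : ∀ x y → 𝟙 (P x) * δ _≟ʸ_ y (f x) ≡ 𝟙 (Q y) * δ _≟ˣ_ x (g y)
  graph-transpose x y = begin
    𝟙 (P x) * δ _≟ʸ_ y (f x)      ≡⟨ 𝟙-∧ (P x) _ ⟨
    𝟙 (does (T? (P x) ×-dec (y ≟ʸ f x)))  ≡⟨ cong 𝟙 (does-⇔ (graph x y) (T? (P x) ×-dec (y ≟ʸ f x)) (T? (Q y) ×-dec (x ≟ˣ g y))) ⟩
    𝟙 (does (T? (Q y) ×-dec (x ≟ˣ g y)))  ≡⟨ 𝟙-∧ (Q y) _ ⟩
    𝟙 (Q y) * δ _≟ˣ_ x (g y)      ∎

punchIn-<ᵇ : ∀ {m} (j : Fin (suc m)) a b → (toℕ (punchIn j a) <ᵇ toℕ (punchIn j b)) ≡ (toℕ a <ᵇ toℕ b)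
punchIn-<ᵇ zero    a       b       = refl
punchIn-<ᵇ (suc j) zero    zero    = refl
punchIn-<ᵇ (suc j) zero    (suc b) = refl
punchIn-<ᵇ (suc j) (suc a) zero    = refl
punchIn-<ᵇ (suc j) (suc a) (suc b) = punchIn-<ᵇ j a b

involution-injective : ∀ {n} (F : Fin n → Fin n) → (∀ i → F (F i) ≡ i) → ∀ {a b} → F a ≡ F b → a ≡ b
involution-injective F inv {a} {b} eq = trans (sym (inv a)) (trans (cong F eq) (inv b))

tabulate-≗ : ∀ {A : Set} {n} {g : Fin n → A} (xs : Vec A n) → (∀ i → g i ≡ lookup xs i) → tabulateᵛ g ≡ xs
tabulate-≗ xs eq = trans (tabulate-cong eq) (tabulate∘lookup xs)

-- The predecessor, and punchOut, made total by a default.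
predOr : ∀ {n} → Fin n → Fin (suc n) → Fin n
predOr d zero    = d
predOr d (suc y) = y

punchOutOr : ∀ {n} → Fin n → (j : Fin (suc n)) → Fin (suc n) → Fin n
punchOutOr d j z with j ≟ᶠ z
... | yes _   = d
... | no j≢z = punchOut j≢z

punchOutOr-punchIn : ∀ {n} (d : Fin n) j i → punchOutOr d j (punchIn j i) ≡ i
punchOutOr-punchIn d j i with j ≟ᶠ punchIn j i
... | yes j≡ = ⊥-elim (punchInᵢ≢i j i (sym j≡))
... | no _   = trans (punchOut-cong j refl) (punchOut-punchIn j)

punchIn-punchOutOr : ∀ {n} (d : Fin n) {j z} → j ≢ z → punchIn j (punchOutOr d j z) ≡ z
punchIn-punchOutOr d {j} {z} j≢z with j ≟ᶠ z
... | yes j≡z = ⊥-elim (j≢z j≡z)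
... | no j≢z′ = punchIn-punchOut j≢z′

insertAt-unique : ∀ {A : Set} {n} (xs : Fin n → A) i v (h : Fin (suc n) → A) →
                  h i ≡ v → (∀ k → h (punchIn i k) ≡ xs k) → ∀ z → insertAt xs i v z ≡ h z
insertAt-unique xs i v h hi h∘punchIn z with i ≟ᶠ z
... | yes refl = trans (insertAt-lookup xs i v) (sym hi)
... | no i≢z   = begin
  insertAt xs i v z                            ≡⟨ cong (insertAt xs i v) (punchIn-punchOut i≢z) ⟨
  insertAt xs i v (punchIn i (punchOut i≢z))  ≡⟨ insertAt-punchIn xs i v (punchOut i≢z) ⟩
  xs (punchOut i≢z)                            ≡⟨ h∘punchIn (punchOut i≢z) ⟨
  h (punchIn i (punchOut i≢z))                 ≡⟨ cong h (punchIn-punchOut i≢z) ⟩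
  h z                                          ∎
  where open ≡-Reasoning

suc-predOr : ∀ {n} {d : Fin n} {y : Fin (suc n)} → y ≢ zero → suc (predOr d y) ≡ y
suc-predOr {y = zero}  y≢0 = ⊥-elim (y≢0 refl)
suc-predOr {y = suc y} _   = refl

-- A pair (f , t) with f : Fin n → Fin n
-- and signs t : Fin n → Bool is judged by local conditions at each point
-- (f is an involution there; signs off fixed points are the dummy true)
-- and by a weight on the statistics (#2-cycles, #(+)-fixed, #(−)-fixed).

Weight : Set
Weight = ℕ → ℕ → ℕ → Bool

module _ {n : ℕ} (f : Fin n → Fin n) where
  fixAt invAt cycAt : Fin n → Bool
  fixAt i = ⌊ f i ≟ᶠ i ⌋
  invAt i = ⌊ f (f i) ≟ᶠ i ⌋
  -- each 2-cycle {i, f i} is counted at its smaller point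
  cycAt i = toℕ i <ᵇ toℕ (f i)

  normAt plusAt minusAt : (Fin n → Bool) → Fin n → Bool
  normAt  t i = fixAt i ∨ t i
  plusAt  t i = fixAt i ∧ t i
  minusAt t i = fixAt i ∧ not (t i)

-- A candidate is accepted when f is an involution, the signs are normalised
-- and the weight accepts its statistics; this is the shape of isSignedInvWithK.
accept : Weight → Bool → Bool → ℕ → ℕ → ℕ → Bool
accept W inv norm c a m = inv ∧ norm ∧ W c a m

accept-cong : ∀ W {i i′ o o′ c c′ a a′ m m′} → i ≡ i′ → o ≡ o′ → c ≡ c′ → a ≡ a′ → m ≡ m′ →
              accept W i o c a m ≡ accept W i′ o′ c′ a′ m′
accept-cong W refl refl refl refl refl = refl

isSigned : ∀ n → Weight → (Fin n → Fin n) → (Fin n → Bool) → Bool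
isSigned n W f t = accept W (AllF n (invAt f)) (AllF n (normAt f t))
                            (ΣF n (𝟙 ∘ cycAt f)) (ΣF n (𝟙 ∘ plusAt f t)) (ΣF n (𝟙 ∘ minusAt f t))

Sig : ℕ → Set
Sig n = Vec (Fin n) n × Vec Bool n

sigs : ∀ n → List (Sig n)
sigs n = cartesianProduct (allVecs (allFin n) n) (allVecs (true ∷ false ∷ []) n)

_≟ˢ_ : ∀ {n} → DecidableEquality (Sig n)
_≟ˢ_ = ≡-decᵛ _≟ᶠ_ ≟× ≡-decᵛ _≟ᵇ_

enumeration-sigs : ∀ n → Enumeration _≟ˢ_ (sigs n)
enumeration-sigs n = enumeration-cartesian (enumeration-allVecs (enumeration-allFin n) n)
                                           (enumeration-allVecs enumeration-Bool n)

isSignedSig : ∀ n → Weight → Sig n → Bool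
isSignedSig n W (π , s) = isSigned n W (lookup π) (lookup s)

count : ℕ → Weight → ℕ
count n W = sumL (sigs n) (𝟙 ∘ isSignedSig n W)

balanced : ℕ → ℕ → ℕ → Weight
balanced k p q c a m = (c ≡ᵇ k) ∧ ((a + q) ≡ᵇ (m + p))

γ-count : ∀ k p q → γ k p q ≡ count (p + q) (balanced k p q)
γ-count k p q = trans (length-filter (isSignedInvWithK k p q) (sigs n)) (sumL-cong (sigs n) same-test)
  where
  n : ℕ
  n = p + q
  same-test : ∀ x → 𝟙 (isSignedInvWithK k p q x) ≡ 𝟙 (isSignedSig n (balanced k p q) x)
  same-test (π , s) = cong 𝟙 (accept-cong (balanced k p q)
    (allᵇ-tabulate n id _) (allᵇ-tabulate n id _)
    (countFin-ΣF n _) (countFin-ΣF n _) (countFin-ΣF n _))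

module Relabel {m n} (e : Fin m → Fin n) (e-injective : ∀ {a b} → e a ≡ e b → a ≡ b)
               (e-<ᵇ : ∀ a b → (toℕ (e a) <ᵇ toℕ (e b)) ≡ (toℕ a <ᵇ toℕ b))
               {F : Fin n → Fin n} {S : Fin n → Bool} {f : Fin m → Fin m} {t : Fin m → Bool}
               (F∘e : ∀ i → F (e i) ≡ e (f i)) (S∘e : ∀ i → S (e i) ≡ t i) where

  fixAt-e : ∀ i → fixAt F (e i) ≡ fixAt f i
  fixAt-e i = trans (cong (λ z → ⌊ z ≟ᶠ e i ⌋) (F∘e i)) (⌊≟⌋-injective e e-injective (f i) i)

  invAt-e : ∀ i → invAt F (e i) ≡ invAt f i
  invAt-e i = begin
    ⌊ F (F (e i)) ≟ᶠ e i ⌋  ≡⟨ cong (λ z → ⌊ F z ≟ᶠ e i ⌋) (F∘e i) ⟩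
    ⌊ F (e (f i)) ≟ᶠ e i ⌋  ≡⟨ cong (λ z → ⌊ z ≟ᶠ e i ⌋) (F∘e (f i)) ⟩
    ⌊ e (f (f i)) ≟ᶠ e i ⌋  ≡⟨ ⌊≟⌋-injective e e-injective (f (f i)) i ⟩
    ⌊ f (f i) ≟ᶠ i ⌋        ∎
    where open ≡-Reasoning

  cycAt-e : ∀ i → cycAt F (e i) ≡ cycAt f i
  cycAt-e i = trans (cong (λ z → toℕ (e i) <ᵇ toℕ z) (F∘e i)) (e-<ᵇ i (f i))

  normAt-e : ∀ i → normAt F S (e i) ≡ normAt f t i
  plusAt-e : ∀ i → plusAt F S (e i) ≡ plusAt f t i
  minusAt-e : ∀ i → minusAt F S (e i) ≡ minusAt f t i
  normAt-e  i = cong₂ _∨_ (fixAt-e i) (S∘e i)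
  plusAt-e  i = cong₂ _∧_ (fixAt-e i) (S∘e i)
  minusAt-e i = cong₂ _∧_ (fixAt-e i) (cong not (S∘e i))

module _ {n} (F : Fin n → Fin n) where
  fixAt-at : ∀ {i k} → F i ≡ k → fixAt F i ≡ ⌊ k ≟ᶠ i ⌋
  fixAt-at {i} = cong (λ z → ⌊ z ≟ᶠ i ⌋)

  -- i and k swapped (or i fixed, when k = i)
  invAt-swapped : ∀ {i k} → F i ≡ k → F k ≡ i → invAt F i ≡ true
  invAt-swapped {i} Fi Fk = trans (cong (λ z → ⌊ F z ≟ᶠ i ⌋) Fi) (trans (cong (λ z → ⌊ z ≟ᶠ i ⌋) Fk) (⌊≟⌋-refl i))

  cycAt-at : ∀ {i k} → F i ≡ k → cycAt F i ≡ (toℕ i <ᵇ toℕ k)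
  cycAt-at {i} = cong (λ z → toℕ i <ᵇ toℕ z)

  normAt-dummy : ∀ {S i} → S i ≡ true → normAt F S i ≡ true
  normAt-dummy {S} {i} Si = trans (cong (fixAt F i ∨_) Si) (∨-zeroʳ (fixAt F i))

-- How the weight changes when the first point is removed: a fixed point of
-- sign b adds to the (+)- or (−)-count, a 2-cycle adds to the cycle count.

shiftFixed : Bool → Weight → Weight
shiftFixed b W c a m = W c (𝟙 b + a) (𝟙 (not b) + m)

shiftCycle : Weight → Weight
shiftCycle W c = W (suc c)

signed-firstFixed : ∀ n W b {F : Fin (suc n) → Fin (suc n)} {S f t} →
                    F zero ≡ zero → S zero ≡ b →
                    (∀ i → F (suc i) ≡ suc (f i)) → (∀ i → S (suc i) ≡ t i) →
                    isSigned (suc n) W F S ≡ isSigned n (shiftFixed b W) f t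
signed-firstFixed n W b {F} {S} F0 S0 F∘suc S∘suc = accept-cong W
  (cong₂ _∧_ (invAt-swapped F F0 F0) (AllF-cong n invAt-e))
  (cong₂ _∧_ (cong (_∨ S zero) (fixAt-at F F0)) (AllF-cong n normAt-e))
  (cong₂ _+_ (cong 𝟙 (cycAt-at F F0)) (ΣF-cong n (cong 𝟙 ∘ cycAt-e)))
  (cong₂ _+_ (cong 𝟙 (cong₂ _∧_ (fixAt-at F F0) S0)) (ΣF-cong n (cong 𝟙 ∘ plusAt-e)))
  (cong₂ _+_ (cong 𝟙 (cong₂ _∧_ (fixAt-at F F0) (cong not S0))) (ΣF-cong n (cong 𝟙 ∘ minusAt-e)))
  where open Relabel suc suc-injective (λ _ _ → refl) {F} {S} F∘suc S∘suc

signed-firstInCycle : ∀ m W (j : Fin (suc m)) {F : Fin (suc (suc m)) → Fin (suc (suc m))} {S f t} →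
                      F zero ≡ suc j → F (suc j) ≡ zero → S zero ≡ true → S (suc j) ≡ true →
                      (∀ i → F (suc (punchIn j i)) ≡ suc (punchIn j (f i))) →
                      (∀ i → S (suc (punchIn j i)) ≡ t i) →
                      isSigned (suc (suc m)) W F S ≡ isSigned m (shiftCycle W) f t
signed-firstInCycle m W j {F} {S} F0 Fj S0 Sj F∘e S∘e = accept-cong W
  (trans (AllF-pair (invAt F))
         (cong₂ _∧_ (invAt-swapped F F0 Fj) (cong₂ _∧_ (invAt-swapped F Fj F0) (AllF-cong m invAt-e))))
  (trans (AllF-pair (normAt F S))
         (cong₂ _∧_ (normAt-dummy F {S} S0) (cong₂ _∧_ (normAt-dummy F {S} Sj) (AllF-cong m normAt-e))))
  (trans (ΣF-pair (𝟙 ∘ cycAt F))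
         (cong₂ _+_ (cong 𝟙 (cycAt-at F F0)) (cong₂ _+_ (cong 𝟙 (cycAt-at F Fj)) (ΣF-cong m (cong 𝟙 ∘ cycAt-e)))))
  (trans (ΣF-pair (𝟙 ∘ plusAt F S))
         (cong₂ _+_ (cong 𝟙 (cong (_∧ S zero) (fixAt-at F F0)))
                    (cong₂ _+_ (cong 𝟙 (cong (_∧ S (suc j)) (fixAt-at F Fj))) (ΣF-cong m (cong 𝟙 ∘ plusAt-e)))))
  (trans (ΣF-pair (𝟙 ∘ minusAt F S))
         (cong₂ _+_ (cong 𝟙 (cong (_∧ not (S zero)) (fixAt-at F F0)))
                    (cong₂ _+_ (cong 𝟙 (cong (_∧ not (S (suc j))) (fixAt-at F Fj))) (ΣF-cong m (cong 𝟙 ∘ minusAt-e)))))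
  where
  open Relabel (suc ∘ punchIn j) (punchIn-injective j _ _ ∘ suc-injective) (punchIn-<ᵇ j) {F} {S} F∘e S∘e
  AllF-pair : ∀ h → AllF (suc (suc m)) h ≡ h zero ∧ (h (suc j) ∧ AllF m (h ∘ suc ∘ punchIn j))
  AllF-pair h = cong (h zero ∧_) (AllF-punchIn m j (h ∘ suc))
  ΣF-pair : ∀ h → ΣF (suc (suc m)) h ≡ h zero + (h (suc j) + ΣF m (h ∘ suc ∘ punchIn j))
  ΣF-pair h = cong (h zero +_) (ΣF-punchIn m j (h ∘ suc))

module _ {n} (W : Weight) (F : Fin n → Fin n) (S : Fin n → Bool) (signed : T (isSigned n W F S)) where
  signed⇒involution : ∀ i → F (F i) ≡ i
  signed⇒involution i = toWitness (AllF-elim n (proj₁ (Equivalence.to T-∧ signed)) i)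

  signed⇒normalised : ∀ i → F i ≢ i → S i ≡ true
  signed⇒normalised i moved with Equivalence.to T-∨ (AllF-elim n normalised i)
    where normalised = proj₁ (Equivalence.to T-∧ (proj₂ (Equivalence.to (T-∧ {AllF n (invAt F)}) signed)))
  ... | inj₁ fixed = ⊥-elim (moved (toWitness fixed))
  ... | inj₂ sign  = Equivalence.to T-≡ sign

isZero : ∀ {n} → Fin (suc n) → Bool
isZero zero    = true
isZero (suc _) = false

firstFixedWith : ∀ {n} → Bool → Sig (suc n) → Bool
firstFixedWith b (π , s) = isZero (lookup π zero) ∧ ⌊ lookup s zero ≟ᵇ b ⌋

firstMoved : ∀ {n} → Sig (suc n) → Bool
firstMoved (π , s) = not (isZero (lookup π zero))

split-first : ∀ {n} (P : Bool) (x : Sig (suc n)) →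
              𝟙 P ≡ 𝟙 (P ∧ firstFixedWith false x) + 𝟙 (P ∧ firstFixedWith true x) + 𝟙 (P ∧ firstMoved x)
split-first false x       = refl
split-first true  (π , s) with lookup π zero | lookup s zero
... | zero  | true  = refl
... | zero  | false = refl
... | suc _ | true  = refl
... | suc _ | false = refl

isZero-true : ∀ {n} (y : Fin (suc n)) → T (isZero y) → y ≡ zero
isZero-true zero _ = refl

extendFixed : ∀ {n} → Bool → Sig n → Sig (suc n)
extendFixed b (π , s) = (zero ∷ mapᵛ suc π , b ∷ s)

restrictFixed : ∀ {n} → Sig (suc n) → Sig n
restrictFixed (_ ∷ π , _ ∷ s) = (tabulateᵛ (λ i → predOr i (lookup π i)) , s)

extendFixed-accepted : ∀ n W b y → isSignedSig (suc n) W (extendFixed b y) ∧ firstFixedWith b (extendFixed b y)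
                                   ≡ isSignedSig n (shiftFixed b W) y
extendFixed-accepted n W b (π , s) = begin
  isSignedSig (suc n) W x ∧ (true ∧ ⌊ b ≟ᵇ b ⌋)  ≡⟨ cong (isSignedSig (suc n) W x ∧_) (≟ᵇ-refl b) ⟩
  isSignedSig (suc n) W x ∧ true                  ≡⟨ ∧-identityʳ _ ⟩
  isSignedSig (suc n) W x                         ≡⟨ signed-firstFixed n W b {lookup (proj₁ x)} {lookup (proj₂ x)}
                                                       refl refl (λ i → lookup-map i suc π) (λ _ → refl) ⟩
  isSignedSig n (shiftFixed b W) (π , s)          ∎
  where
  open ≡-Reasoning
  x : Sig (suc n)
  x = extendFixed b (π , s)

restrictFixed∘extendFixed : ∀ {n} b (y : Sig n) → restrictFixed (extendFixed b y) ≡ y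
restrictFixed∘extendFixed b (π , s) = cong (_, s) (tabulate-≗ π (λ i → cong (predOr i) (lookup-map i suc π)))

extendFixed∘restrictFixed : ∀ n W b x → T (isSignedSig (suc n) W x ∧ firstFixedWith b x) →
                            extendFixed b (restrictFixed x) ≡ x
extendFixed∘restrictFixed n W b (p₀ ∷ π , s₀ ∷ s) accepted =
  cong₂ _,_ (cong₂ _∷_ (sym p₀≡0) π-restored) (cong (_∷ s) (sym (toWitness (proj₂ first))))
  where
  F : Fin (suc n) → Fin (suc n)
  F = lookup (p₀ ∷ π)
  signed : T (isSignedSig (suc n) W (p₀ ∷ π , s₀ ∷ s))
  signed = proj₁ (∧-elim (isSignedSig (suc n) W (p₀ ∷ π , s₀ ∷ s)) accepted)
  first : T (isZero p₀) × T ⌊ s₀ ≟ᵇ b ⌋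
  first = ∧-elim (isZero p₀) (proj₂ (∧-elim (isSignedSig (suc n) W (p₀ ∷ π , s₀ ∷ s)) accepted))
  p₀≡0 : p₀ ≡ zero
  p₀≡0 = isZero-true p₀ (proj₁ first)
  π-nonzero : ∀ i → lookup π i ≢ zero
  π-nonzero i eq with () ← involution-injective F (signed⇒involution W F (lookup (s₀ ∷ s)) signed) {suc i} {zero} (trans eq (sym p₀≡0))
  π-restored : mapᵛ suc (tabulateᵛ (λ i → predOr i (lookup π i))) ≡ π
  π-restored = trans (sym (tabulate-∘ suc (λ i → predOr i (lookup π i)))) (tabulate-≗ π (λ i → suc-predOr (π-nonzero i)))

count-firstFixed : ∀ n W b → sumL (sigs (suc n)) (λ x → 𝟙 (isSignedSig (suc n) W x ∧ firstFixedWith b x))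
                             ≡ count n (shiftFixed b W)
count-firstFixed n W b =
  bijection-count (enumeration-sigs (suc n)) (enumeration-sigs n)
                  (λ x → isSignedSig (suc n) W x ∧ firstFixedWith b x) (isSignedSig n (shiftFixed b W))
                  restrictFixed (extendFixed b)
                  (extendFixed-accepted n W b) (extendFixed∘restrictFixed n W b) (restrictFixed∘extendFixed b)

cycleMap : ∀ {m} → Fin (suc m) → (Fin m → Fin m) → Fin (suc (suc m)) → Fin (suc (suc m))
cycleMap j f = insertAt (insertAt (suc ∘ punchIn j ∘ f) j zero) zero (suc j)

cycleSign : ∀ {m} → Fin (suc m) → (Fin m → Bool) → Fin (suc (suc m)) → Bool
cycleSign j t = insertAt (insertAt t j true) zero true

extendCycle : ∀ {m} → Fin (suc m) × Sig m → Sig (suc (suc m))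
extendCycle (j , π , s) = (tabulateᵛ (cycleMap j (lookup π)) , tabulateᵛ (cycleSign j (lookup s)))

-- the index of v once the points zero and suc j are deleted (d if v is one of them)
squeeze : ∀ {m} → Fin (suc m) → Fin m → Fin (suc (suc m)) → Fin m
squeeze j d v = punchOutOr d j (predOr j v)

squeeze-punchIn : ∀ {m} (j : Fin (suc m)) d i → squeeze j d (suc (punchIn j i)) ≡ i
squeeze-punchIn j d i = punchOutOr-punchIn d j i

punchIn-squeeze : ∀ {m} (j : Fin (suc m)) d {v} → v ≢ zero → v ≢ suc j → suc (punchIn j (squeeze j d v)) ≡ v
punchIn-squeeze j d {zero}  v≢0 _     = ⊥-elim (v≢0 refl)
punchIn-squeeze j d {suc w} _   v≢j = cong suc (punchIn-punchOutOr d (λ j≡w → v≢j (cong suc (sym j≡w))))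

restrictCycleAt : ∀ {m} → Fin (suc m) → Sig (suc (suc m)) → Fin (suc m) × Sig m
restrictCycleAt j (π , s) = (j , tabulateᵛ (λ i → squeeze j i (lookup π (suc (punchIn j i))))
                               , tabulateᵛ (λ i → lookup s (suc (punchIn j i))))

restrictCycle : ∀ {m} → Sig (suc (suc m)) → Fin (suc m) × Sig m
restrictCycle (π , s) = restrictCycleAt (predOr zero (lookup π zero)) (π , s)

extendCycle-accepted : ∀ m W y → isSignedSig (suc (suc m)) W (extendCycle y) ∧ firstMoved (extendCycle y)
                                 ≡ isSignedSig m (shiftCycle W) (proj₂ y)
extendCycle-accepted m W (j , π , s) = begin
  isSignedSig (suc (suc m)) W x ∧ not (isZero (lookup F zero))
    ≡⟨ cong (λ z → isSignedSig (suc (suc m)) W x ∧ not (isZero z)) (lookup∘tabulate G zero) ⟩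
  isSignedSig (suc (suc m)) W x ∧ true
    ≡⟨ ∧-identityʳ _ ⟩
  isSignedSig (suc (suc m)) W x
    ≡⟨ signed-firstInCycle m W j {lookup F} {lookup S}
         (lookup∘tabulate G zero) (trans (lookup∘tabulate G (suc j)) (insertAt-lookup _ j zero))
         (lookup∘tabulate H zero) (trans (lookup∘tabulate H (suc j)) (insertAt-lookup _ j true))
         (λ i → trans (lookup∘tabulate G (suc (punchIn j i))) (insertAt-punchIn _ j zero i))
         (λ i → trans (lookup∘tabulate H (suc (punchIn j i))) (insertAt-punchIn _ j true i)) ⟩
  isSignedSig m (shiftCycle W) (π , s)
    ∎
  where
  open ≡-Reasoning
  x : Sig (suc (suc m))
  x = extendCycle (j , π , s)
  G : Fin (suc (suc m)) → Fin (suc (suc m))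
  G = cycleMap j (lookup π)
  H : Fin (suc (suc m)) → Bool
  H = cycleSign j (lookup s)
  F : Vec (Fin (suc (suc m))) (suc (suc m))
  F = tabulateᵛ G
  S : Vec Bool (suc (suc m))
  S = tabulateᵛ H

restrictCycle∘extendCycle : ∀ {m} (y : Fin (suc m) × Sig m) → restrictCycle (extendCycle y) ≡ y
restrictCycle∘extendCycle {m} (j , π , s) = begin
  restrictCycleAt (predOr zero (lookup F zero)) (F , S)  ≡⟨ cong (λ v → restrictCycleAt (predOr zero v) (F , S)) (lookup∘tabulate G zero) ⟩
  restrictCycleAt j (F , S)                               ≡⟨ cong₂ (λ π′ s′ → (j , π′ , s′)) (tabulate-≗ π restored-π) (tabulate-≗ s restored-s) ⟩
  (j , π , s)                                             ∎
  where
  open ≡-Reasoning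
  G : Fin (suc (suc m)) → Fin (suc (suc m))
  G = cycleMap j (lookup π)
  H : Fin (suc (suc m)) → Bool
  H = cycleSign j (lookup s)
  F : Vec (Fin (suc (suc m))) (suc (suc m))
  F = tabulateᵛ G
  S : Vec Bool (suc (suc m))
  S = tabulateᵛ H
  restored-π : ∀ i → squeeze j i (lookup F (suc (punchIn j i))) ≡ lookup π i
  restored-π i = trans (cong (squeeze j i) (trans (lookup∘tabulate G (suc (punchIn j i))) (insertAt-punchIn _ j zero i)))
                       (squeeze-punchIn j i (lookup π i))
  restored-s : ∀ i → lookup S (suc (punchIn j i)) ≡ lookup s i
  restored-s i = trans (lookup∘tabulate H (suc (punchIn j i))) (insertAt-punchIn _ j true i)

-- An accepted candidate whose first point is moved is an involution with
-- F 0 = suc j and F (suc j) = 0 for j = partner, and it is rebuilt from its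
-- restriction by insertAt-unique, twice.
extendCycle∘restrictCycle : ∀ m W x → T (isSignedSig (suc (suc m)) W x ∧ firstMoved x) →
                            extendCycle (restrictCycle x) ≡ x
extendCycle∘restrictCycle m W (π , s) accepted = cong₂ _,_ (tabulate-≗ π restored-π) (tabulate-≗ s restored-s)
  where
  F : Fin (suc (suc m)) → Fin (suc (suc m))
  F = lookup π
  S : Fin (suc (suc m)) → Bool
  S = lookup s
  j : Fin (suc m)
  j = predOr zero (F zero)
  signed : T (isSignedSig (suc (suc m)) W (π , s))
  signed = proj₁ (∧-elim (isSignedSig (suc (suc m)) W (π , s)) accepted)
  involution : ∀ i → F (F i) ≡ i
  involution = signed⇒involution W F S signed
  F0 : F zero ≡ suc j
  F0 = sym (suc-predOr (λ F0≡0 → subst (T ∘ not ∘ isZero) F0≡0 (proj₂ (∧-elim (isSignedSig (suc (suc m)) W (π , s)) accepted))))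
  Fj : F (suc j) ≡ zero
  Fj = trans (cong F (sym F0)) (involution zero)
  F-avoids-0 : ∀ i → F (suc (punchIn j i)) ≢ zero
  F-avoids-0 i eq = punchInᵢ≢i j i (suc-injective (involution-injective F involution (trans eq (sym Fj))))
  F-avoids-j : ∀ i → F (suc (punchIn j i)) ≢ suc j
  F-avoids-j i eq with () ← involution-injective F involution (trans eq (sym F0))
  π′ : Vec (Fin m) m
  π′ = tabulateᵛ (λ i → squeeze j i (F (suc (punchIn j i))))
  s′ : Vec Bool m
  s′ = tabulateᵛ (λ i → S (suc (punchIn j i)))
  restored-π : ∀ z → cycleMap j (lookup π′) z ≡ F z
  restored-π = insertAt-unique _ zero (suc j) F F0 (λ k → sym (inner k))
    where
    inner : ∀ k → insertAt (suc ∘ punchIn j ∘ lookup π′) j zero k ≡ F (suc k)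
    inner = insertAt-unique _ j zero (F ∘ suc) Fj
              (λ i → trans (sym (punchIn-squeeze j i (F-avoids-0 i) (F-avoids-j i)))
                           (cong (suc ∘ punchIn j) (sym (lookup∘tabulate (λ i → squeeze j i (F (suc (punchIn j i)))) i))))
  restored-s : ∀ z → cycleSign j (lookup s′) z ≡ S z
  restored-s = insertAt-unique _ zero true S
                 (signed⇒normalised W F S signed zero (λ eq → 0≢1+n (trans (sym eq) F0)))
                 (λ k → sym (insertAt-unique _ j true (S ∘ suc)
                    (signed⇒normalised W F S signed (suc j) (λ eq → 0≢1+n (trans (sym Fj) eq)))
                    (λ i → sym (lookup∘tabulate (λ i → S (suc (punchIn j i))) i)) k))

count-firstInCycle : ∀ m W → sumL (sigs (suc (suc m))) (λ x → 𝟙 (isSignedSig (suc (suc m)) W x ∧ firstMoved x))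
                             ≡ suc m * count m (shiftCycle W)
count-firstInCycle m W = begin
  sumL (sigs (suc (suc m))) (λ x → 𝟙 (isSignedSig (suc (suc m)) W x ∧ firstMoved x))
    ≡⟨ bijection-count (enumeration-sigs (suc (suc m)))
                       (enumeration-cartesian (enumeration-allFin (suc m)) (enumeration-sigs m))
                       (λ x → isSignedSig (suc (suc m)) W x ∧ firstMoved x) (Q ∘ proj₂)
                       restrictCycle extendCycle
                       (extendCycle-accepted m W) (extendCycle∘restrictCycle m W) restrictCycle∘extendCycle ⟩
  sumL (cartesianProduct (allFin (suc m)) (sigs m)) (𝟙 ∘ Q ∘ proj₂)
    ≡⟨ sumL-cartesian (allFin (suc m)) (sigs m) (𝟙 ∘ Q ∘ proj₂) ⟩
  sumL (allFin (suc m)) (λ _ → count m (shiftCycle W))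
    ≡⟨ sumL-tabulate (suc m) id (λ _ → count m (shiftCycle W)) ⟩
  ΣF (suc m) (λ _ → count m (shiftCycle W))
    ≡⟨ ΣF-const (suc m) (count m (shiftCycle W)) ⟩
  suc m * count m (shiftCycle W)
    ∎
  where
  open ≡-Reasoning
  Q : Sig m → Bool
  Q = isSignedSig m (shiftCycle W)

count-firstMoved : ∀ n W → sumL (sigs (suc n)) (λ x → 𝟙 (isSignedSig (suc n) W x ∧ firstMoved x))
                           ≡ n * count (n ∸ 1) (shiftCycle W)
count-firstMoved zero    W = trans (sumL-cong (sigs 1) never-moved) (sumL-zero (sigs 1))
  where
  never-moved : ∀ x → 𝟙 (isSignedSig 1 W x ∧ firstMoved x) ≡ 0
  never-moved (zero ∷ [] , s) = cong 𝟙 (∧-zeroʳ _)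
count-firstMoved (suc m) W = count-firstInCycle m W

count-recurrence : ∀ n W → count (suc n) W ≡
                   count n (shiftFixed false W) + count n (shiftFixed true W) + n * count (n ∸ 1) (shiftCycle W)
count-recurrence n W = begin
  count (suc n) W                                      ≡⟨ sumL-cong xs (λ x → split-first (P x) x) ⟩
  sumL xs (λ x → minus x + plus x + moved x)           ≡⟨ sumL-+ xs (λ x → minus x + plus x) moved ⟩
  sumL xs (λ x → minus x + plus x) + sumL xs moved     ≡⟨ cong (_+ sumL xs moved) (sumL-+ xs minus plus) ⟩
  sumL xs minus + sumL xs plus + sumL xs moved         ≡⟨ cong₂ _+_ (cong₂ _+_ (count-firstFixed n W false) (count-firstFixed n W true))
                                                                    (count-firstMoved n W) ⟩
  count n (shiftFixed false W) + count n (shiftFixed true W) + n * count (n ∸ 1) (shiftCycle W) ∎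
  where
  open ≡-Reasoning
  xs : List (Sig (suc n))
  xs = sigs (suc n)
  P : Sig (suc n) → Bool
  P = isSignedSig (suc n) W
  minus plus moved : Sig (suc n) → ℕ
  minus x = 𝟙 (P x ∧ firstFixedWith false x)
  plus  x = 𝟙 (P x ∧ firstFixedWith true x)
  moved x = 𝟙 (P x ∧ firstMoved x)

-- Counts only see admissible statistics: the (c, a, m) with a + m + 2c = n,
-- the only ones a signed involution on n points can have.  Two weights that
-- agree there have equal counts (induction on n through the recurrence; the
-- 2-cycle term needs the step from n + 2 to n, hence moved-congᵃ).

Admissible : ℕ → Weight → Weight → Set
Admissible n W W′ = ∀ c a m → a + m + c + c ≡ n → W c a m ≡ W′ c a m

count-congᵃ : ∀ n {W W′} → Admissible n W W′ → count n W ≡ count n W′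
moved-congᵃ : ∀ n {W W′} → Admissible (suc n) W W′ →
              n * count (n ∸ 1) (shiftCycle W) ≡ n * count (n ∸ 1) (shiftCycle W′)

count-congᵃ zero    eq = cong (λ b → 𝟙 b + 0) (eq 0 0 0 refl)
count-congᵃ (suc n) {W} {W′} eq = begin
  count (suc n) W   ≡⟨ count-recurrence n W ⟩
  count n (shiftFixed false W) + count n (shiftFixed true W) + n * count (n ∸ 1) (shiftCycle W)
    ≡⟨ cong₂ _+_ (cong₂ _+_ (count-congᵃ n (λ c a m e → eq c a (suc m) (trans (extra-minus a m c) (cong suc e))))
                            (count-congᵃ n (λ c a m e → eq c (suc a) m (cong suc e))))
                 (moved-congᵃ n eq) ⟩
  count n (shiftFixed false W′) + count n (shiftFixed true W′) + n * count (n ∸ 1) (shiftCycle W′)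
    ≡⟨ count-recurrence n W′ ⟨
  count (suc n) W′  ∎
  where
  open ≡-Reasoning
  extra-minus : ∀ a m c → a + suc m + c + c ≡ suc (a + m + c + c)
  extra-minus = solve-∀

moved-congᵃ zero    eq = refl
moved-congᵃ (suc n) eq = cong (suc n *_) (count-congᵃ n (λ c a m e → eq (suc c) a m (trans (extra-cycle a m c) (cong (λ k → suc (suc k)) e))))
  where
  extra-cycle : ∀ a m c → a + m + suc c + suc c ≡ suc (suc (a + m + c + c))
  extra-cycle = solve-∀

count-cong : ∀ n {W W′} → (∀ c a m → W c a m ≡ W′ c a m) → count n W ≡ count n W′
count-cong n eq = count-congᵃ n (λ c a m _ → eq c a m)

never : Weight
never _ _ _ = false

count-never : ∀ n → count n never ≡ 0
count-never n = trans (sumL-cong (sigs n) rejected) (sumL-zero (sigs n))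
  where
  rejected : ∀ x → 𝟙 (isSignedSig n never x) ≡ 0
  rejected (π , s) = cong 𝟙 (trans (cong (AllF n (invAt (lookup π)) ∧_) (∧-zeroʳ _)) (∧-zeroʳ _))

monochrome : Bool → Weight
monochrome true  c a m = (c ≡ᵇ 0) ∧ (m ≡ᵇ 0)
monochrome false c a m = (c ≡ᵇ 0) ∧ (a ≡ᵇ 0)

count-monochrome : ∀ b n → count n (monochrome b) ≡ 1
count-monochrome true  zero    = refl
count-monochrome false zero    = refl
count-monochrome true  (suc n) = begin
  count (suc n) (monochrome true)  ≡⟨ count-recurrence n (monochrome true) ⟩
  count n (shiftFixed false (monochrome true)) + count n (monochrome true) + n * count (n ∸ 1) never
    ≡⟨ cong₂ _+_ (cong₂ _+_ no-minus (count-monochrome true n)) (cong (n *_) (count-never (n ∸ 1))) ⟩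
  0 + 1 + n * 0                     ≡⟨ cong suc (*-zeroʳ n) ⟩
  1                                 ∎
  where
  open ≡-Reasoning
  no-minus : count n (shiftFixed false (monochrome true)) ≡ 0
  no-minus = trans (count-cong n (λ c a m → ∧-zeroʳ (c ≡ᵇ 0))) (count-never n)
count-monochrome false (suc n) = begin
  count (suc n) (monochrome false)  ≡⟨ count-recurrence n (monochrome false) ⟩
  count n (monochrome false) + count n (shiftFixed true (monochrome false)) + n * count (n ∸ 1) never
    ≡⟨ cong₂ _+_ (cong₂ _+_ (count-monochrome false n) no-plus) (cong (n *_) (count-never (n ∸ 1))) ⟩
  1 + 0 + n * 0                      ≡⟨ cong suc (*-zeroʳ n) ⟩
  1                                  ∎
  where
  open ≡-Reasoning
  no-plus : count n (shiftFixed true (monochrome false)) ≡ 0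
  no-plus = trans (count-cong n (λ c a m → ∧-zeroʳ (c ≡ᵇ 0))) (count-never n)

balanced-stats : ∀ {a m c p q} → a + m + c + c ≡ p + q → a + q ≡ m + p → m + c ≡ q
balanced-stats {a} {m} {c} {p} {q} size balance = sym (*-cancelˡ-≡ q (m + c) 2 (+-cancelˡ-≡ p _ _ (begin
  p + 2 * q                  ≡⟨ regroup₁ p q ⟩
  p + q + q                  ≡⟨ cong (_+ q) size ⟨
  a + m + c + c + q          ≡⟨ regroup₂ a m c q ⟩
  (a + q) + (m + c + c)      ≡⟨ cong (_+ (m + c + c)) balance ⟩
  (m + p) + (m + c + c)      ≡⟨ regroup₃ m p c ⟩
  p + 2 * (m + c)            ∎)))
  where
  open ≡-Reasoning
  regroup₁ : ∀ p q → p + 2 * q ≡ p + q + q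
  regroup₁ = solve-∀
  regroup₂ : ∀ a m c q → a + m + c + c + q ≡ (a + q) + (m + c + c)
  regroup₂ = solve-∀
  regroup₃ : ∀ m p c → (m + p) + (m + c + c) ≡ p + 2 * (m + c)
  regroup₃ = solve-∀

balanced-stats′ : ∀ {a m c p q} → a + m + c + c ≡ p + q → a + q ≡ m + p → a + c ≡ p
balanced-stats′ {a} {m} {c} {p} {q} size balance =
  balanced-stats (trans (swap-first m a c) (trans size (+-comm p q))) (sym balance)
  where
  swap-first : ∀ m a c → m + a + c + c ≡ a + m + c + c
  swap-first = solve-∀

balanced-elim : ∀ {k p q} c a m → T (balanced k p q c a m) → c ≡ k × a + q ≡ m + p
balanced-elim {k} {p} {q} c a m accepted with ∧-elim (c ≡ᵇ k) accepted
... | c≡k , balance = ≡ᵇ⇒≡ c k c≡k , ≡ᵇ⇒≡ (a + q) (m + p) balance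

-- Since c ≤ m + c = q, there are no balanced involutions with more than q 2-cycles.
γ-above-q : ∀ k p q → q < k → γ k p q ≡ 0
γ-above-q k p q q<k = trans (γ-count k p q) (trans (count-congᵃ (p + q) rejected) (count-never (p + q)))
  where
  rejected : Admissible (p + q) (balanced k p q) never
  rejected c a m size = false-unless λ accepted → let (c≡k , balance) = balanced-elim c a m accepted in
    <⇒≱ q<k (subst (_≤ q) c≡k (subst (c ≤_) (balanced-stats size balance) (m≤n+m c m)))

A-γ : ∀ p q → A p q ≈ₚ λ k → γ k p q
A-γ p q k with k ≤ᵇ q in k≤ᵇq
... | true  = refl
... | false = sym (γ-above-q k p q (≰⇒> (λ k≤q → subst T k≤ᵇq (≤⇒≤ᵇ k≤q))))

-- For q = 0 the balanced involutions are the monochrome (+) ones.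
γ-q≡0 : ∀ p → γ 0 p 0 ≡ 1
γ-q≡0 p = begin
  γ 0 p 0                         ≡⟨ γ-count 0 p 0 ⟩
  count (p + 0) (balanced 0 p 0)  ≡⟨ cong (λ n → count n (balanced 0 p 0)) (+-identityʳ p) ⟩
  count p (balanced 0 p 0)        ≡⟨ count-congᵃ p same ⟩
  count p (monochrome true)       ≡⟨ count-monochrome true p ⟩
  1                               ∎
  where
  open ≡-Reasoning
  same : Admissible p (balanced 0 p 0) (monochrome true)
  same (suc c) a m size = refl
  same zero    a m size = ≡ᵇ-⇔ {a + 0} {m + p}
                            (mk⇔ (λ balance → trans (sym (+-identityʳ m)) (balanced-stats {a} {m} {0} {p} {0} size′ balance))
                                     (λ { refl → trans (sym (+-identityʳ-3 a)) size }))
    where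
    size′ : a + m + 0 + 0 ≡ p + 0
    size′ = trans size (sym (+-identityʳ p))
    +-identityʳ-3 : ∀ a → a + 0 + 0 + 0 ≡ a + 0
    +-identityʳ-3 = solve-∀

-- For p = 0 the balanced involutions are the monochrome (−) ones.
γ-p≡0 : ∀ q → γ 0 0 q ≡ 1
γ-p≡0 q = trans (γ-count 0 0 q) (trans (count-congᵃ q same) (count-monochrome false q))
  where
  same : Admissible q (balanced 0 0 q) (monochrome false)
  same (suc c) a m size = refl
  same zero    a m size = ≡ᵇ-⇔ {a + q} {m + 0}
                            (mk⇔ (λ balance → trans (sym (+-identityʳ a)) (balanced-stats′ {a} {m} {0} {0} {q} size balance))
                                     (λ { refl → trans (sym size) (+-identityʳ-2 m) }))
    where
    +-identityʳ-2 : ∀ m → 0 + m + 0 + 0 ≡ m + 0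
    +-identityʳ-2 = solve-∀

-- For p = 0 there are no 2-cycles, since c ≤ a + c = p.
γ-p≡0-cycles : ∀ k q → γ (suc k) 0 q ≡ 0
γ-p≡0-cycles k q = trans (γ-count (suc k) 0 q) (trans (count-congᵃ q rejected) (count-never q))
  where
  rejected : Admissible q (balanced (suc k) 0 q) never
  rejected c a m size = false-unless λ accepted → let (c≡k , balance) = balanced-elim c a m accepted in
    ℕ-0≢1+n (trans (sym (m+n≡0⇒n≡0 a (balanced-stats′ size balance))) c≡k)

-- The recurrence for γ: removing the first point of a balanced involution on
-- (p+1) + (q+1) points leaves a balanced one on (p+1) + q points (a (−)-fixed
-- point), on p + (q+1) points (a (+)-fixed point), or, in p + q + 1 ways,
-- one on p + q points with one 2-cycle fewer.
γ-recurrence : ∀ p q k → γ k (suc p) (suc q) ≡ γ k (suc p) q + γ k p (suc q) + (p + suc q) * t× (λ k → γ k p q) k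
γ-recurrence p q k = begin
  γ k (suc p) (suc q)
    ≡⟨ γ-count k (suc p) (suc q) ⟩
  count (suc n) B
    ≡⟨ count-recurrence n B ⟩
  count n (shiftFixed false B) + count n (shiftFixed true B) + n * count (n ∸ 1) (shiftCycle B)
    ≡⟨ cong₂ _+_ (cong₂ _+_ minus-removed plus-removed) (cong (n *_) (cycle-removed k)) ⟩
  γ k (suc p) q + γ k p (suc q) + n * t× (λ k → γ k p q) k
    ∎
  where
  open ≡-Reasoning
  n : ℕ
  n = p + suc q
  B : Weight
  B = balanced k (suc p) (suc q)

  minus-removed : count n (shiftFixed false B) ≡ γ k (suc p) q
  minus-removed = begin
    count n (shiftFixed false B)                   ≡⟨ cong (λ n → count n (shiftFixed false B)) (+-suc p q) ⟩
    count (suc p + q) (shiftFixed false B)         ≡⟨ count-cong (suc p + q) (λ c a m → cong (λ z → (c ≡ᵇ k) ∧ (z ≡ᵇ suc (m + suc p))) (+-suc a q)) ⟩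
    count (suc p + q) (balanced k (suc p) q)       ≡⟨ γ-count k (suc p) q ⟨
    γ k (suc p) q                                  ∎

  plus-removed : count n (shiftFixed true B) ≡ γ k p (suc q)
  plus-removed = begin
    count n (shiftFixed true B)                    ≡⟨ count-cong n (λ c a m → cong (λ z → (c ≡ᵇ k) ∧ (suc (a + suc q) ≡ᵇ z)) (+-suc m p)) ⟩
    count n (balanced k p (suc q))                 ≡⟨ γ-count k p (suc q) ⟨
    γ k p (suc q)                                  ∎

  cycle-removed : ∀ k → count (n ∸ 1) (shiftCycle (balanced k (suc p) (suc q))) ≡ t× (λ k → γ k p q) k
  cycle-removed zero     = count-never (n ∸ 1)
  cycle-removed (suc k′) = begin
    count (n ∸ 1) (shiftCycle (balanced (suc k′) (suc p) (suc q)))  ≡⟨ cong (λ n → count (n ∸ 1) (shiftCycle (balanced (suc k′) (suc p) (suc q)))) (+-suc p q) ⟩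
    count (p + q) (shiftCycle (balanced (suc k′) (suc p) (suc q)))  ≡⟨ count-cong (p + q) (λ c a m → cong₂ (λ x y → (c ≡ᵇ k′) ∧ (x ≡ᵇ y)) (+-suc a q) (+-suc m p)) ⟩
    count (p + q) (balanced k′ p q)                                   ≡⟨ γ-count k′ p q ⟨
    γ k′ p q                                                          ∎

t×-cong : ∀ {f g} → f ≈ₚ g → t× f ≈ₚ t× g
t×-cong f≈g zero    = refl
t×-cong f≈g (suc k) = f≈g k

proposition7p9 : ((p q : ℕ) → 1 ≤ p → 1 ≤ q →
                    A p q ≈ₚ (A p (q ∸ 1) ⊕ A (p ∸ 1) q ⊕ ((p + q ∸ 1) · t× (A (p ∸ 1) (q ∸ 1)))))
                 × ((p : ℕ) → A p 0 ≈ₚ onePoly)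
                 × ((q : ℕ) → A 0 q ≈ₚ onePoly)
-- Through A = γ (coefficientwise), the recurrence is γ-recurrence and the
-- initial values are γ-q≡0, γ-p≡0 and γ-p≡0-cycles.
proposition7p9 = recurrence , initial-q , initial-p
  where
  open ≡-Reasoning
  recurrence : (p q : ℕ) → 1 ≤ p → 1 ≤ q →
               A p q ≈ₚ (A p (q ∸ 1) ⊕ A (p ∸ 1) q ⊕ ((p + q ∸ 1) · t× (A (p ∸ 1) (q ∸ 1))))
  recurrence (suc p) (suc q) _ _ k = begin
    A (suc p) (suc q) k
      ≡⟨ A-γ (suc p) (suc q) k ⟩
    γ k (suc p) (suc q)
      ≡⟨ γ-recurrence p q k ⟩
    γ k (suc p) q + γ k p (suc q) + (p + suc q) * t× (λ k → γ k p q) k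
      ≡⟨ cong₂ _+_ (cong₂ _+_ (A-γ (suc p) q k) (A-γ p (suc q) k)) (cong ((p + suc q) *_) (t×-cong (A-γ p q) k)) ⟨
    A (suc p) q k + A p (suc q) k + (p + suc q) * t× (A p q) k
      ∎
  initial-q : (p : ℕ) → A p 0 ≈ₚ onePoly
  initial-q p zero    = γ-q≡0 p
  initial-q p (suc k) = refl
  initial-p : (q : ℕ) → A 0 q ≈ₚ onePoly
  initial-p q zero    = γ-p≡0 q
  initial-p q (suc k) = trans (A-γ 0 q (suc k)) (γ-p≡0-cycles k q)
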